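{- Let $X$ and $Y$ be disjoint finite sets and let $R \subseteq X \times Y$ be a relation. Let $B := \{\text{bicliques of } R\} \cup C_X \cup C_Y$ (the biclique complex of $R$). Then $B$ collapses to $C_X$ and $B$ collapses to $C_Y$.
   Context: A simplicial complex with ground set $W$ (a finite set) is a set of subsets of $W$ closed under taking subsets; its elements are faces. Write $x\,R\,y$ for $(x,y) \in R$; for $U \subseteq X$, $V \subseteq Y$, write $U\,\mathbf{R}\,V$ if $u\,R\,v$ for all $u \in U$, $v \in V$. A subset $U \subseteq X$ is $Y$-conic if it is empty or there is $y \in Y$ with $u\,R\,y$ for all $u \in U$; $C_X$ is the set of all $Y$-conic subsets of $X$. A subset $V \subseteq Y$ is $X$-conic if it is empty or there is $x \in X$ with $x\,R\,v$ for all $v \in V$; $C_Y$ is the set of all $X$-conic subsets of $Y$. A biclique of $R$ is a set $U \cup V$ with $U \subseteq X$, $V \subseteq Y$ both nonempty and $U\,\mathbf{R}\,V$. ($B$ is a simplicial complex with ground set $X\cup Y$ containing $C_X$ and $C_Y$.) For faces $A,B$ write $A \prec B$ if $A \subseteq B$ and $|B\setminus A| = 1$. If $\Gamma \subseteq \Delta$ are simplicial complexes and there are faces $\tau,\sigma \in \Delta\setminus\Gamma$ with $\Delta = \Gamma \cup \{\tau,\sigma\}$ and $\tau \prec \sigma$, then $\Delta$ collapses to $\Gamma$ by an elementary collapse. $\Delta$ collapses to $\Gamma$ if there are simplicial complexes $\Delta_0 = \Delta, \Delta_1, \dots, \Delta_n = \Gamma$ ($n \ge 0$) such that each $\Delta_i$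 collapses to $\Delta_{i+1}$ by an elementary collapse. -}

module Defs where

open import Data.Nat using (ℕ; _+_)
open import Data.Bool using (Bool; true)
open import Data.Fin using (Fin; _↑ˡ_; _↑ʳ_)
open import Data.Fin.Subset using (Subset; _∈_; _∉_; _⊆_; _─_; ∣_∣; Empty; Nonempty)
open import Data.Product using (Σ; ∃; _×_; _,_)
open import Data.Sum using (_⊎_)
open import Relation.Binary.PropositionalEquality using (_≡_)
open import Relation.Nullary using (¬_)
open import Function.Bundles using (_⇔_)
open import Level using (suc; zero)

Complex : ℕ → Set₁
Complex N = Subset N → Set

IsSimplicialComplex : ∀ {N} → Complex N → Set
IsSimplicialComplex {N} Δ = ∀ (A B : Subset N) → A ⊆ B → Δ B → Δ A

_≺_ : ∀ {N} → Subset N → Subset N → Set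
A ≺ B = A ⊆ B × ∣ B ─ A ∣ ≡ 1

-- Δ collapses to Γ by an elementary collapse (Γ ⊆ Δ simplicial complexes
-- are assumed separately where needed).
ElementaryCollapse : ∀ {N} → Complex N → Complex N → Set
ElementaryCollapse {N} Δ Γ =
  Σ (Subset N) λ τ → Σ (Subset N) λ σ →
    Δ τ × ¬ Γ τ × Δ σ × ¬ Γ σ × τ ≺ σ ×
    (∀ A → Δ A ⇔ (Γ A ⊎ (A ≡ τ ⊎ A ≡ σ)))

data Collapses {N} (Δ Γ : Complex N) : Set₁ where
  done : (∀ A → Δ A ⇔ Γ A) → Collapses Δ Γ
  step : (Δ′ : Complex N) → IsSimplicialComplex Δ′ →
         ElementaryCollapse Δ Δ′ → Collapses Δ′ Γ → Collapses Δ Γ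

-- Relation R ⊆ X × Y with X = Fin m, Y = Fin n, ground set X ⊔ Y = Fin (m + n)
-- (x ∈ X is embedded as x ↑ˡ n, y ∈ Y as m ↑ʳ y).

module _ {m n : ℕ} (R : Fin m → Fin n → Bool) where

  InX : Subset (m + n) → Set
  InX A = ∀ (y : Fin n) → (m ↑ʳ y) ∉ A

  InY : Subset (m + n) → Set
  InY A = ∀ (x : Fin m) → (x ↑ˡ n) ∉ A

  CX : Complex (m + n)
  CX A = InX A × (Empty A ⊎ Σ (Fin n) λ y → ∀ (x : Fin m) → (x ↑ˡ n) ∈ A → R x y ≡ true)

  CY : Complex (m + n)
  CY A = InY A × (Empty A ⊎ Σ (Fin m) λ x → ∀ (y : Fin n) → (m ↑ʳ y) ∈ A → R x y ≡ true)

  Biclique : Complex (m + n)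
  Biclique A =
    (Σ (Fin m) λ x → (x ↑ˡ n) ∈ A) ×
    (Σ (Fin n) λ y → (m ↑ʳ y) ∈ A) ×
    (∀ (x : Fin m) (y : Fin n) → (x ↑ˡ n) ∈ A → (m ↑ʳ y) ∈ A → R x y ≡ true)

  BicliqueComplex : Complex (m + n)
  BicliqueComplex A = Biclique A ⊎ CX A ⊎ CY A

{-# OPTIONS --safe #-}
-- A face of B outside C_X is U ∪ V with V ⊆ Y nonempty and X-conic and U R V.
-- Choose for every such V an apex x_V ∈ X with x_V R V, depending on V alone.
-- Then U ∪ V ∖ {x_V} ≺ U ∪ V ∪ {x_V} pairs off the faces of B outside C_X, and
-- removing the pairs in order of decreasing |V|, and for equal V of decreasing
-- |U|, is a sequence of elementary collapses: every coface of a pair that is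
-- still present belongs to the pair itself.  Exchanging X and Y gives C_Y.
module Submission where

open import Defs
open import Data.Bool using (Bool; true; false)
open import Data.Bool.Properties using () renaming (_≟_ to _≟ᵇ_)
open import Data.Empty using (⊥-elim)
open import Data.Fin using (Fin; zero; suc; _↑ˡ_; _↑ʳ_; splitAt)
open import Data.Fin.Properties
  using (any?; all?; ↑ˡ-injective; ↑ʳ-injective; splitAt-↑ˡ; splitAt-↑ʳ; splitAt⁻¹-↑ˡ; splitAt⁻¹-↑ʳ)
  renaming (_≟_ to _≟ᶠ_)
open import Data.Fin.Subset using (Subset; Side; inside; outside; _∈_; _∉_; _⊆_; _─_; ∣_∣; Empty)
open import Data.Fin.Subset.Properties using (_∈?_; ∣p∣≤n; p⊆q⇒∣p∣≤∣q∣; drop-∷-⊆; out⊆; s⊆s; ⊆-refl)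
open import Data.List using (List; []; _∷_; [_]; map; _++_)
open import Data.List.Membership.Propositional using () renaming (_∈_ to _∈ᴸ_; _∉_ to _∉ᴸ_)
open import Data.List.Membership.Propositional.Properties using (∈-++⁺ˡ; ∈-++⁺ʳ; ∈-map⁺)
open import Data.List.Relation.Unary.Any using (here; there)
open import Data.Maybe using (Maybe; just; nothing)
open import Data.Nat using (ℕ; zero; suc; _+_; _*_; _≤_; _<_; s≤s)
open import Data.Nat.Properties as ℕ using (≤∧≢⇒<; <-irrefl; ≤-pred)
open import Data.Product using (∃; _×_; _,_)
open import Data.Sum using (_⊎_; inj₁; inj₂; map₂; swap)
open import Data.Vec using ([]; _∷_; lookup; tabulate; _[_]≔_; here; there)
open import Data.Vec.Properties
  using (≡-dec; []=⇒lookup; lookup⇒[]=; lookup∘update′; lookup∘tabulate; []≔-idempotent; []≔-lookup; tabulate-cong)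
open import Function using (_∘_; flip)
open import Function.Bundles using (_⇔_; mk⇔; Equivalence)
open import Function.Definitions using (Injective)
import Function.Properties.Equivalence as ⇔
open import Relation.Binary.PropositionalEquality
  using (_≡_; _≢_; refl; sym; trans; cong; subst; subst₂; module ≡-Reasoning)
open import Relation.Nullary using (¬_; Dec; yes; no)
open import Relation.Nullary.Decidable using (_×-dec_; _→-dec_)
open import Relation.Unary using (Decidable; _∪_)

_≅_ : ∀ {N} → Complex N → Complex N → Set
Δ ≅ Δ′ = ∀ A → Δ A ⇔ Δ′ A

Collapses-respˡ : ∀ {N} {Δ Δ′ Γ : Complex N} → Δ ≅ Δ′ → Collapses Δ′ Γ → Collapses Δ Γ
Collapses-respˡ Δ≅Δ′ (done Δ′≅Γ) = done (λ A → ⇔.trans (Δ≅Δ′ A) (Δ′≅Γ A))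
Collapses-respˡ Δ≅Δ′ (step Δ″ Δ″-simplicial (τ , σ , τ∈ , τ∉ , σ∈ , σ∉ , τ≺σ , Δ′≅) rest) =
  step Δ″ Δ″-simplicial
    (τ , σ , Equivalence.from (Δ≅Δ′ τ) τ∈ , τ∉ , Equivalence.from (Δ≅Δ′ σ) σ∈ , σ∉ , τ≺σ ,
     λ A → ⇔.trans (Δ≅Δ′ A) (Δ′≅ A))
    rest

allSubsets : ∀ N → List (Subset N)
allSubsets zero    = [ [] ]
allSubsets (suc N) = map (inside ∷_) (allSubsets N) ++ map (outside ∷_) (allSubsets N)

∈-allSubsets : ∀ {N} (A : Subset N) → A ∈ᴸ allSubsets N
∈-allSubsets []                  = here refl
∈-allSubsets (true ∷ A)          = ∈-++⁺ˡ (∈-map⁺ (inside ∷_) (∈-allSubsets A))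
∈-allSubsets {suc N} (false ∷ A) =
  ∈-++⁺ʳ (map (inside ∷_) (allSubsets N)) (∈-map⁺ (outside ∷_) (∈-allSubsets A))

_≟ˢ_ : ∀ {N} (A B : Subset N) → Dec (A ≡ B)
_≟ˢ_ = ≡-dec _≟ᵇ_

[]≔outside⊆ : ∀ {n} (p : Subset n) x → p [ x ]≔ outside ⊆ p
[]≔outside⊆ (s ∷ p) zero    = out⊆ ⊆-refl
[]≔outside⊆ (s ∷ p) (suc x) = s⊆s ([]≔outside⊆ p x)

⊆[]≔inside : ∀ {n} (p : Subset n) x → p ⊆ p [ x ]≔ inside
⊆[]≔inside (s ∷ p) zero    = λ { here → here ; (there y∈p) → there y∈p }
⊆[]≔inside (s ∷ p) (suc x) = s⊆s (⊆[]≔inside p x)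

[]≔-mono : ∀ {n} {p q : Subset n} x v → p ⊆ q → p [ x ]≔ v ⊆ q [ x ]≔ v
[]≔-mono {p = s ∷ p} {t ∷ q} zero    v p⊆q = s⊆s (drop-∷-⊆ p⊆q)
[]≔-mono {p = s ∷ p} {t ∷ q} (suc x) v p⊆q here with p⊆q here
... | here = here
[]≔-mono {p = s ∷ p} {t ∷ q} (suc x) v p⊆q (there y∈) = there ([]≔-mono x v (drop-∷-⊆ p⊆q) y∈)

∈-[]≔⁻ : ∀ {n} (p : Subset n) {x y} v → y ≢ x → y ∈ p [ x ]≔ v → y ∈ p
∈-[]≔⁻ p {x} {y} v y≢x y∈ = lookup⇒[]= y p (trans (sym (lookup∘update′ y≢x p v)) ([]=⇒lookup y∈))

∣p─p∣≡0 : ∀ {n} (p : Subset n) → ∣ p ─ p ∣ ≡ 0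
∣p─p∣≡0 []          = refl
∣p─p∣≡0 (true ∷ p)  = ∣p─p∣≡0 p
∣p─p∣≡0 (false ∷ p) = ∣p─p∣≡0 p

[]≔outside≺[]≔inside : ∀ {n} (p : Subset n) x → (p [ x ]≔ outside) ≺ (p [ x ]≔ inside)
[]≔outside≺[]≔inside p x = (λ y∈ → ⊆[]≔inside p x ([]≔outside⊆ p x y∈)) , ∣difference∣≡1 p x
  where
  ∣difference∣≡1 : ∀ {n} (p : Subset n) x → ∣ (p [ x ]≔ inside) ─ (p [ x ]≔ outside) ∣ ≡ 1
  ∣difference∣≡1 (s ∷ p)     zero    = cong suc (∣p─p∣≡0 p)
  ∣difference∣≡1 (true ∷ p)  (suc x) = ∣difference∣≡1 p x
  ∣difference∣≡1 (false ∷ p) (suc x) = ∣difference∣≡1 p x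

p⊆q∧∣p∣≡∣q∣⇒p≡q : ∀ {n} {p q : Subset n} → p ⊆ q → ∣ p ∣ ≡ ∣ q ∣ → p ≡ q
p⊆q∧∣p∣≡∣q∣⇒p≡q {p = []}        {[]}        _   _ = refl
p⊆q∧∣p∣≡∣q∣⇒p≡q {p = true ∷ p}  {true ∷ q}  p⊆q eq =
  cong (inside ∷_) (p⊆q∧∣p∣≡∣q∣⇒p≡q (drop-∷-⊆ p⊆q) (ℕ.suc-injective eq))
p⊆q∧∣p∣≡∣q∣⇒p≡q {p = false ∷ p} {false ∷ q} p⊆q eq =
  cong (outside ∷_) (p⊆q∧∣p∣≡∣q∣⇒p≡q (drop-∷-⊆ p⊆q) eq)
p⊆q∧∣p∣≡∣q∣⇒p≡q {p = true ∷ p}  {false ∷ q} p⊆q eq with p⊆q here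
... | ()
p⊆q∧∣p∣≡∣q∣⇒p≡q {p = false ∷ p} {true ∷ q}  p⊆q eq =
  ⊥-elim (<-irrefl eq (s≤s (p⊆q⇒∣p∣≤∣q∣ (drop-∷-⊆ p⊆q))))

x+[1+n]*y<x′+[1+n]*y′ : ∀ {n x x′ y y′} → x ≤ n → y < y′ → x + suc n * y < x′ + suc n * y′
x+[1+n]*y<x′+[1+n]*y′ {n} {x} {x′} {y} {y′} x≤n y<y′ = begin-strict
  x + suc n * y      ≤⟨ ℕ.+-monoˡ-≤ (suc n * y) x≤n ⟩
  n + suc n * y      <⟨ ℕ.n<1+n (n + suc n * y) ⟩
  suc n + suc n * y  ≡⟨ ℕ.*-suc (suc n) y ⟨
  suc n * suc y      ≤⟨ ℕ.*-monoʳ-≤ (suc n) y<y′ ⟩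
  suc n * y′         ≤⟨ ℕ.m≤n+m (suc n * y′) x′ ⟩
  x′ + suc n * y′    ∎
  where open ℕ.≤-Reasoning

-- A face of D lies
-- only below faces of D of larger height or of its own pair, so the pairs can
-- be removed one by one in order of decreasing height.
record GradedPairing {N} (D : Complex N) : Set where
  field
    lower upper      : Subset N → Subset N
    height           : Subset N → ℕ
    maxHeight        : ℕ
    lower-D          : ∀ {A} → D A → D (lower A)
    upper-D          : ∀ {A} → D A → D (upper (lower A))
    lower-lower      : ∀ {A} → D A → lower (lower A) ≡ lower A
    lower-upper      : ∀ {A} → D A → lower (upper (lower A)) ≡ lower A
    lower-or-upper   : ∀ {A} → D A → A ≡ lower A ⊎ A ≡ upper (lower A)
    lower≺upper      : ∀ {A} → D A → lower A ≺ upper (lower A)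
    height<max       : ∀ {A} → D A → height (lower A) < maxHeight
    height-mono      : ∀ {A B} → A ⊆ B → D A → D B → height (lower A) ≤ height (lower B)
    height-injective : ∀ {A B} → A ⊆ B → D A → D B →
                       height (lower A) ≡ height (lower B) → lower A ≡ lower B

module PairingCollapse {N} {Γ D : Complex N}
  (Γ-simplicial : IsSimplicialComplex Γ)
  (Γ∪D-simplicial : ∀ A B → A ⊆ B → D B → Γ A ⊎ D A)
  (Γ∩D-empty : ∀ A → Γ A → ¬ D A)
  (D? : Decidable D)
  (pairing : GradedPairing D)
  where

  open GradedPairing pairing
  open import Data.List.Membership.DecPropositional (_≟ˢ_ {N}) using () renaming (_∈?_ to _∈ᴸ?_)

  Stage : ℕ → List (Subset N) → Complex N
  Stage k L A = Γ A ⊎ (D A × (height (lower A) < k ⊎ (height (lower A) ≡ k × lower A ∈ᴸ L)))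

  Stage-simplicial : ∀ k L → IsSimplicialComplex (Stage k L)
  Stage-simplicial k L A B A⊆B (inj₁ γ) = inj₁ (Γ-simplicial A B A⊆B γ)
  Stage-simplicial k L A B A⊆B (inj₂ (dB , hB)) with Γ∪D-simplicial A B A⊆B dB
  ... | inj₁ γ = inj₁ γ
  ... | inj₂ dA with height-mono A⊆B dA dB | hB
  ...   | hA≤hB | inj₁ hB<k = inj₂ (dA , inj₁ (ℕ.<-≤-trans (s≤s hA≤hB) hB<k))
  ...   | hA≤hB | inj₂ (hB≡k , lowB∈L) with height (lower A) ℕ.≟ k
  ...     | no hA≢k = inj₂ (dA , inj₁ (≤∧≢⇒< (subst (height (lower A) ≤_) hB≡k hA≤hB) hA≢k))
  ...     | yes hA≡k = inj₂ (dA , inj₂ (hA≡k , subst (_∈ᴸ L) (sym lowA≡lowB) lowB∈L))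
    where
    lowA≡lowB : lower A ≡ lower B
    lowA≡lowB = height-injective A⊆B dA dB (trans hA≡k (sym hB≡k))

  IsLowerAt : ℕ → Complex N
  IsLowerAt k e = D e × lower e ≡ e × height e ≡ k

  IsLowerAt? : ∀ k → Decidable (IsLowerAt k)
  IsLowerAt? k e = D? e ×-dec (lower e ≟ˢ e) ×-dec (height e ℕ.≟ k)

  lower-IsLowerAt : ∀ {k A} → D A → height (lower A) ≡ k → IsLowerAt k (lower A)
  lower-IsLowerAt d h = lower-D d , lower-lower d , h

  redundant-∈ : ∀ {k e L A} → ¬ IsLowerAt k e ⊎ e ∈ᴸ L →
                D A → height (lower A) ≡ k → lower A ≡ e → lower A ∈ᴸ L
  redundant-∈ (inj₁ ¬lowerAt) d h refl = ⊥-elim (¬lowerAt (lower-IsLowerAt d h))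
  redundant-∈ (inj₂ e∈L)      d h refl = e∈L

  Stage-weaken : ∀ {k e L} → ∀ A → Stage k L A → Stage k (e ∷ L) A
  Stage-weaken A (inj₁ γ)                     = inj₁ γ
  Stage-weaken A (inj₂ (d , inj₁ h<k))        = inj₂ (d , inj₁ h<k)
  Stage-weaken A (inj₂ (d , inj₂ (h , low∈L))) = inj₂ (d , inj₂ (h , there low∈L))

  Stage-skip : ∀ {k e L} → ¬ IsLowerAt k e ⊎ e ∈ᴸ L → Stage k (e ∷ L) ≅ Stage k L
  Stage-skip {k} {e} {L} redundant A = mk⇔ to (Stage-weaken A)
    where
    to : Stage k (e ∷ L) A → Stage k L A
    to (inj₁ γ)                            = inj₁ γ
    to (inj₂ (d , inj₁ h<k))               = inj₂ (d , inj₁ h<k)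
    to (inj₂ (d , inj₂ (h , here low≡e)))  = inj₂ (d , inj₂ (h , redundant-∈ redundant d h low≡e))
    to (inj₂ (d , inj₂ (h , there low∈L))) = inj₂ (d , inj₂ (h , low∈L))

  Stage-removePair : ∀ {k L A} → D A → height (lower A) ≡ k → lower A ∉ᴸ L →
                     ElementaryCollapse (Stage k (lower A ∷ L)) (Stage k L)
  Stage-removePair {k} {L} {A} d h≡k low∉L =
    lower A , upper (lower A) ,
    inPair (lower-D d) (lower-lower d) , notInRest (lower-D d) (lower-lower d) ,
    inPair (upper-D d) (lower-upper d) , notInRest (upper-D d) (lower-upper d) ,
    lower≺upper d , λ C → mk⇔ to (from C)
    where
    inPair : ∀ {C} → D C → lower C ≡ lower A → Stage k (lower A ∷ L) C
    inPair dC eq = inj₂ (dC , inj₂ (trans (cong height eq) h≡k , here eq))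
    notInRest : ∀ {C} → D C → lower C ≡ lower A → ¬ Stage k L C
    notInRest dC eq (inj₁ γ)                      = Γ∩D-empty _ γ dC
    notInRest dC eq (inj₂ (_ , inj₁ h<k))         = <-irrefl (trans (cong height eq) h≡k) h<k
    notInRest dC eq (inj₂ (_ , inj₂ (_ , low∈L))) = low∉L (subst (_∈ᴸ L) eq low∈L)
    to : ∀ {C} → Stage k (lower A ∷ L) C → Stage k L C ⊎ (C ≡ lower A ⊎ C ≡ upper (lower A))
    to (inj₁ γ)                            = inj₁ (inj₁ γ)
    to (inj₂ (dC , inj₁ h<k))              = inj₁ (inj₂ (dC , inj₁ h<k))
    to (inj₂ (dC , inj₂ (h , there low∈L))) = inj₁ (inj₂ (dC , inj₂ (h , low∈L)))
    to (inj₂ (dC , inj₂ (h , here eq))) with lower-or-upper dC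
    ... | inj₁ C≡low = inj₂ (inj₁ (trans C≡low eq))
    ... | inj₂ C≡up  = inj₂ (inj₂ (trans C≡up (cong upper eq)))
    from : ∀ C → Stage k L C ⊎ (C ≡ lower A ⊎ C ≡ upper (lower A)) → Stage k (lower A ∷ L) C
    from C (inj₁ c)           = Stage-weaken C c
    from C (inj₂ (inj₁ refl)) = inPair (lower-D d) (lower-lower d)
    from C (inj₂ (inj₂ refl)) = inPair (upper-D d) (lower-upper d)

  Stage-collapses-from : ∀ {k} → Collapses (Stage k []) Γ → ∀ L → Collapses (Stage k L) Γ
  Stage-collapses-from base [] = base
  Stage-collapses-from {k} base (e ∷ L) with e ∈ᴸ? L | IsLowerAt? k e
  ... | yes e∈L | _           = Collapses-respˡ (Stage-skip (inj₂ e∈L)) (Stage-collapses-from base L)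
  ... | no _    | no ¬lowerAt =
    Collapses-respˡ (Stage-skip (inj₁ ¬lowerAt)) (Stage-collapses-from base L)
  ... | no e∉L  | yes (d , low≡e , h≡k) =
    subst (λ τ → Collapses (Stage k (τ ∷ L)) Γ) low≡e
      (step (Stage k L) (Stage-simplicial k L)
        (Stage-removePair d (trans (cong height low≡e) h≡k) (e∉L ∘ subst (_∈ᴸ L) low≡e))
        (Stage-collapses-from base L))

  Stage-zero : Stage 0 [] ≅ Γ
  Stage-zero A = mk⇔ to inj₁
    where
    to : Stage 0 [] A → Γ A
    to (inj₁ γ)                    = γ
    to (inj₂ (_ , inj₂ (_ , ())))

  Stage-suc : ∀ k → Stage (suc k) [] ≅ Stage k (allSubsets N)
  Stage-suc k A = mk⇔ to from
    where
    to : Stage (suc k) [] A → Stage k (allSubsets N) A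
    to (inj₁ γ) = inj₁ γ
    to (inj₂ (d , inj₁ h<1+k)) with height (lower A) ℕ.≟ k
    ... | yes h≡k = inj₂ (d , inj₂ (h≡k , ∈-allSubsets (lower A)))
    ... | no h≢k  = inj₂ (d , inj₁ (≤∧≢⇒< (≤-pred h<1+k) h≢k))
    from : Stage k (allSubsets N) A → Stage (suc k) [] A
    from (inj₁ γ) = inj₁ γ
    from (inj₂ (d , inj₁ h<k))       = inj₂ (d , inj₁ (ℕ.m<n⇒m<1+n h<k))
    from (inj₂ (d , inj₂ (h≡k , _))) = inj₂ (d , inj₁ (ℕ.≤-reflexive (cong suc h≡k)))

  Stage-collapses : ∀ k → Collapses (Stage k []) Γ
  Stage-collapses zero    = done Stage-zero
  Stage-collapses (suc k) =
    Collapses-respˡ (Stage-suc k) (Stage-collapses-from (Stage-collapses k) (allSubsets N))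

  Γ∪D≅Stage-max : (Γ ∪ D) ≅ Stage maxHeight []
  Γ∪D≅Stage-max A = mk⇔ to from
    where
    to : (Γ ∪ D) A → Stage maxHeight [] A
    to (inj₁ γ) = inj₁ γ
    to (inj₂ d) = inj₂ (d , inj₁ (height<max d))
    from : Stage maxHeight [] A → (Γ ∪ D) A
    from (inj₁ γ)       = inj₁ γ
    from (inj₂ (d , _)) = inj₂ d

  collapses : Collapses (Γ ∪ D) Γ
  collapses = Collapses-respˡ Γ∪D≅Stage-max (Stage-collapses maxHeight)

-- Abstracting over the embeddings lets a single proof give both halves of the
-- theorem: the second one is the first for the swapped embeddings and flip R.
module Bipartite {N a b : ℕ} (ιX : Fin a → Fin N) (ιY : Fin b → Fin N) (R : Fin a → Fin b → Bool)
  where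

  HasX HasY Complete : Complex N
  HasX A     = ∃ λ x → ιX x ∈ A
  HasY A     = ∃ λ y → ιY y ∈ A
  Complete A = ∀ x y → ιX x ∈ A → ιY y ∈ A → R x y ≡ true

  Apex : Fin a → Complex N
  Apex x A = ∀ y → ιY y ∈ A → R x y ≡ true

  Cx Cy Bic B : Complex N
  Cx A  = (∀ y → ιY y ∉ A) × (Empty A ⊎ ∃ λ y → ∀ x → ιX x ∈ A → R x y ≡ true)
  Cy A  = (∀ x → ιX x ∉ A) × (Empty A ⊎ ∃ λ x → Apex x A)
  Bic A = HasX A × HasY A × Complete A
  B     = Bic ∪ Cx ∪ Cy

  B∖Cx : Complex N
  B∖Cx A = HasY A × Complete A × ∃ λ x → Apex x A

B-transpose : ∀ {N a b} (ιX : Fin a → Fin N) (ιY : Fin b → Fin N) R →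
              Bipartite.B ιX ιY R ≅ Bipartite.B ιY ιX (flip R)
B-transpose ιX ιY R A = mk⇔ to from
  where
  to : Bipartite.B ιX ιY R A → Bipartite.B ιY ιX (flip R) A
  to (inj₁ (hasX , hasY , complete)) = inj₁ (hasY , hasX , λ y x y∈ x∈ → complete x y x∈ y∈)
  to (inj₂ (inj₁ cx))                = inj₂ (inj₂ cx)
  to (inj₂ (inj₂ cy))                = inj₂ (inj₁ cy)
  from : Bipartite.B ιY ιX (flip R) A → Bipartite.B ιX ιY R A
  from (inj₁ (hasY , hasX , complete)) = inj₁ (hasX , hasY , λ x y x∈ y∈ → complete y x y∈ x∈)
  from (inj₂ (inj₁ cy))                = inj₂ (inj₂ cy)
  from (inj₂ (inj₂ cx))                = inj₂ (inj₁ cx)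

module CollapseToCx {N a b : ℕ} (ιX : Fin a → Fin N) (ιY : Fin b → Fin N)
  (ιX-injective : Injective _≡_ _≡_ ιX)
  (ιX≢ιY : ∀ x y → ιX x ≢ ιY y)
  (ιX-ιY-cover : ∀ v → (∃ λ x → ιX x ≡ v) ⊎ (∃ λ y → ιY y ≡ v))
  (R : Fin a → Fin b → Bool)
  where

  open Bipartite ιX ιY R

  Empty-without-vertices : ∀ {A} → (∀ x → ιX x ∉ A) → (∀ y → ιY y ∉ A) → Empty A
  Empty-without-vertices noX noY (v , v∈A) with ιX-ιY-cover v
  ... | inj₁ (x , refl) = noX x v∈A
  ... | inj₂ (y , refl) = noY y v∈A

  HasY? : Decidable HasY
  HasY? A = any? (λ y → ιY y ∈? A)

  Apex? : ∀ x → Decidable (Apex x)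
  Apex? x A = all? (λ y → ιY y ∈? A →-dec R x y ≟ᵇ true)

  B≅Cx∪B∖Cx : B ≅ (Cx ∪ B∖Cx)
  B≅Cx∪B∖Cx A = mk⇔ to from
    where
    to : B A → (Cx ∪ B∖Cx) A
    to (inj₁ ((x , x∈) , hasY , complete)) = inj₂ (hasY , complete , x , λ y → complete x y x∈)
    to (inj₂ (inj₁ cx))                    = inj₁ cx
    to (inj₂ (inj₂ (noX , empty⊎apex))) with HasY? A
    ... | no ¬hasY = inj₁ (noY , inj₁ (Empty-without-vertices noX noY))
      where
      noY : ∀ y → ιY y ∉ A
      noY y y∈ = ¬hasY (y , y∈)
    ... | yes (y , y∈) = inj₂ ((y , y∈) , (λ x _ x∈ → ⊥-elim (noX x x∈)) , apex empty⊎apex)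
      where
      apex : Empty A ⊎ ∃ (λ x → Apex x A) → ∃ λ x → Apex x A
      apex (inj₁ empty) = ⊥-elim (empty (ιY y , y∈))
      apex (inj₂ apex)  = apex
    from : (Cx ∪ B∖Cx) A → B A
    from (inj₁ cx) = inj₂ (inj₁ cx)
    from (inj₂ (hasY , complete , apex)) with any? (λ x → ιX x ∈? A)
    ... | yes hasX = inj₁ (hasX , hasY , complete)
    ... | no ¬hasX = inj₂ (inj₂ ((λ x x∈ → ¬hasX (x , x∈)) , inj₂ apex))

  B∖Cx? : Decidable B∖Cx
  B∖Cx? A = HasY? A ×-dec complete? ×-dec any? (λ x → Apex? x A)
    where
    complete? : Dec (Complete A)
    complete? = all? λ x → all? λ y → ιX x ∈? A →-dec (ιY y ∈? A →-dec R x y ≟ᵇ true)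

  Cx∩B∖Cx-empty : ∀ A → Cx A → ¬ B∖Cx A
  Cx∩B∖Cx-empty A (noY , _) ((y , y∈) , _) = noY y y∈

  Cx-simplicial : IsSimplicialComplex Cx
  Cx-simplicial A A′ A⊆A′ (noY , empty⊎cone) = (λ y → noY y ∘ A⊆A′) , shrink empty⊎cone
    where
    shrink : Empty A′ ⊎ (∃ λ y → ∀ x → ιX x ∈ A′ → R x y ≡ true) →
             Empty A ⊎ (∃ λ y → ∀ x → ιX x ∈ A → R x y ≡ true)
    shrink (inj₁ empty)      = inj₁ (λ (v , v∈) → empty (v , A⊆A′ v∈))
    shrink (inj₂ (y , cone)) = inj₂ (y , λ x → cone x ∘ A⊆A′)

  B∖Cx-⊆ : ∀ {A A′} → A ⊆ A′ → HasY A → B∖Cx A′ → B∖Cx A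
  B∖Cx-⊆ A⊆A′ hasY (_ , complete , x , apex) =
    hasY , (λ x y x∈ y∈ → complete x y (A⊆A′ x∈) (A⊆A′ y∈)) , x , λ y → apex y ∘ A⊆A′

  Cx∪B∖Cx-simplicial : ∀ A A′ → A ⊆ A′ → B∖Cx A′ → Cx A ⊎ B∖Cx A
  Cx∪B∖Cx-simplicial A A′ A⊆A′ b@((y′ , y′∈) , complete , _) with HasY? A
  ... | yes hasY = inj₂ (B∖Cx-⊆ A⊆A′ hasY b)
  ... | no ¬hasY =
    inj₁ ((λ y y∈ → ¬hasY (y , y∈)) , inj₂ (y′ , λ x x∈ → complete x y′ (A⊆A′ x∈) y′∈))

  yPart : Subset N → Subset b
  yPart A = tabulate (λ y → lookup A (ιY y))

  ∈-yPart⁺ : ∀ {A y} → ιY y ∈ A → y ∈ yPart A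
  ∈-yPart⁺ {A} {y} y∈ = lookup⇒[]= y (yPart A) (trans (lookup∘tabulate _ y) ([]=⇒lookup y∈))

  ∈-yPart⁻ : ∀ {A y} → y ∈ yPart A → ιY y ∈ A
  ∈-yPart⁻ {A} {y} y∈ = lookup⇒[]= (ιY y) A (trans (sym (lookup∘tabulate _ y)) ([]=⇒lookup y∈))

  yPart-mono : ∀ {A A′} → A ⊆ A′ → yPart A ⊆ yPart A′
  yPart-mono A⊆A′ = ∈-yPart⁺ ∘ A⊆A′ ∘ ∈-yPart⁻

  XConic? : ∀ V → Dec (∃ λ x → ∀ y → y ∈ V → R x y ≡ true)
  XConic? V = any? λ x → all? λ y → y ∈? V →-dec R x y ≟ᵇ true

  -- The apex of a face is chosen from its Y-vertices alone, so that adding or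
  -- removing it does not change the choice.
  apex : Subset b → Maybe (Fin a)
  apex V with XConic? V
  ... | yes (x , _) = just x
  ... | no _        = nothing

  apex-sound : ∀ {A x} → apex (yPart A) ≡ just x → Apex x A
  apex-sound {A} eq with XConic? (yPart A)
  apex-sound refl | yes (x , apex) = λ y → apex y ∘ ∈-yPart⁺

  apex-complete : ∀ {A x} → Apex x A → ∃ λ x′ → apex (yPart A) ≡ just x′
  apex-complete {A} {x} apex with XConic? (yPart A)
  ... | yes (x′ , _) = x′ , refl
  ... | no ¬apex     = ⊥-elim (¬apex (x , λ y → apex y ∘ ∈-yPart⁻))

  toggle : Maybe (Fin a) → Side → Subset N → Subset N
  toggle (just x) v A = A [ ιX x ]≔ v
  toggle nothing  v A = A

  yPart-toggle : ∀ m v A → yPart (toggle m v A) ≡ yPart A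
  yPart-toggle (just x) v A = tabulate-cong (λ y → lookup∘update′ (ιX≢ιY x y ∘ sym) A v)
  yPart-toggle nothing  v A = refl

  toggle-toggle : ∀ m v w A → toggle m v (toggle m w A) ≡ toggle m v A
  toggle-toggle (just x) v w A = []≔-idempotent A (ιX x)
  toggle-toggle nothing  v w A = refl

  toggle-lookup : ∀ m A → A ≡ toggle m outside A ⊎ A ≡ toggle m inside A
  toggle-lookup (just x) A with lookup A (ιX x) | []≔-lookup A (ιX x)
  ... | false | A[x]≔false≡A = inj₁ (sym A[x]≔false≡A)
  ... | true  | A[x]≔true≡A  = inj₂ (sym A[x]≔true≡A)
  toggle-lookup nothing A = inj₁ refl

  toggle-mono : ∀ m v {A A′} → A ⊆ A′ → toggle m v A ⊆ toggle m v A′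
  toggle-mono (just x) v = []≔-mono (ιX x) v
  toggle-mono nothing  v = λ A⊆A′ → A⊆A′

  setApex : Side → Subset N → Subset N
  setApex v A = toggle (apex (yPart A)) v A

  yPart-setApex : ∀ v A → yPart (setApex v A) ≡ yPart A
  yPart-setApex v A = yPart-toggle (apex (yPart A)) v A

  setApex-setApex : ∀ v w A → setApex v (setApex w A) ≡ setApex v A
  setApex-setApex v w A = begin
    toggle (apex (yPart (setApex w A))) v (setApex w A)
      ≡⟨ cong (λ V → toggle (apex V) v (setApex w A)) (yPart-setApex w A) ⟩
    toggle m v (toggle m w A)
      ≡⟨ toggle-toggle m v w A ⟩
    toggle m v A
      ∎
    where
    open ≡-Reasoning
    m = apex (yPart A)

  setApex-just : ∀ {A x} v → apex (yPart A) ≡ just x → setApex v A ≡ A [ ιX x ]≔ v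
  setApex-just {A} v eq = cong (λ m → toggle m v A) eq

  setApex-mono : ∀ v {A A′} → A ⊆ A′ → yPart A ≡ yPart A′ → setApex v A ⊆ setApex v A′
  setApex-mono v {A} {A′} A⊆A′ same =
    subst (λ V → setApex v A ⊆ toggle (apex V) v A′) same (toggle-mono (apex (yPart A)) v A⊆A′)

  setApex-outside-⊆ : ∀ A → setApex outside A ⊆ A
  setApex-outside-⊆ A with apex (yPart A)
  ... | just x  = []≔outside⊆ A (ιX x)
  ... | nothing = λ v∈ → v∈

  HasY-setApex : ∀ v {A} → HasY A → HasY (setApex v A)
  HasY-setApex v {A} (y , y∈) = y , ∈-yPart⁻ (subst (y ∈_) (sym (yPart-setApex v A)) (∈-yPart⁺ y∈))

  ιY∈setApex⁻ : ∀ v {A y} → ιY y ∈ setApex v A → ιY y ∈ A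
  ιY∈setApex⁻ v {A} {y} y∈ = ∈-yPart⁻ (subst (y ∈_) (yPart-setApex v A) (∈-yPart⁺ y∈))

  lower-B∖Cx : ∀ {A} → B∖Cx A → B∖Cx (setApex outside A)
  lower-B∖Cx {A} b@(hasY , _) = B∖Cx-⊆ (setApex-outside-⊆ A) (HasY-setApex outside hasY) b

  upper-B∖Cx : ∀ {A} → B∖Cx A → B∖Cx (setApex inside A)
  upper-B∖Cx {A} (hasY , complete , _ , apex₀) with apex-complete apex₀
  ... | x , eq = HasY-setApex inside hasY , complete′ , x , apex′
    where
    apex′ : Apex x (setApex inside A)
    apex′ y = apex-sound eq y ∘ ιY∈setApex⁻ inside
    complete′ : Complete (setApex inside A)
    complete′ x′ y x′∈ y∈ with x′ ≟ᶠ x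
    ... | yes refl = apex′ y y∈
    ... | no x′≢x  = complete x′ y x′∈A (ιY∈setApex⁻ inside y∈)
      where
      x′∈A : ιX x′ ∈ A
      x′∈A = ∈-[]≔⁻ A inside (x′≢x ∘ ιX-injective) (subst (ιX x′ ∈_) (setApex-just inside eq) x′∈)

  lower≺upper : ∀ {A} → B∖Cx A → setApex outside A ≺ setApex inside (setApex outside A)
  lower≺upper {A} (_ , _ , _ , apex₀) with apex-complete apex₀
  ... | x , eq = subst₂ _≺_ (sym (setApex-just outside eq))
                   (sym (trans (setApex-setApex inside outside A) (setApex-just inside eq)))
                   ([]≔outside≺[]≔inside A (ιX x))

  -- Y-vertices weigh more than all X-vertices together: ordered by height, the
  -- pairs are ordered first by their Y-part and then by size.
  height : Subset N → ℕ
  height A = ∣ A ∣ + suc N * ∣ yPart A ∣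

  height-setApex : ∀ v A → height (setApex v A) ≡ ∣ setApex v A ∣ + suc N * ∣ yPart A ∣
  height-setApex v A = cong (λ V → ∣ setApex v A ∣ + suc N * ∣ V ∣) (yPart-setApex v A)

  height<max : ∀ A → height A < suc (N + suc N * b)
  height<max A = s≤s (ℕ.+-mono-≤ (∣p∣≤n A) (ℕ.*-monoʳ-≤ (suc N) (∣p∣≤n (yPart A))))

  height-strict : ∀ v w {A A′} → A ⊆ A′ → yPart A ≢ yPart A′ →
                  height (setApex v A) < height (setApex w A′)
  height-strict v w {A} {A′} A⊆A′ differ =
    subst₂ _<_ (sym (height-setApex v A)) (sym (height-setApex w A′))
      (x+[1+n]*y<x′+[1+n]*y′ {x′ = ∣ setApex w A′ ∣} (∣p∣≤n (setApex v A)) ∣yPart∣<∣yPart∣)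
    where
    ∣yPart∣<∣yPart∣ : ∣ yPart A ∣ < ∣ yPart A′ ∣
    ∣yPart∣<∣yPart∣ =
      ≤∧≢⇒< (p⊆q⇒∣p∣≤∣q∣ (yPart-mono A⊆A′)) (differ ∘ p⊆q∧∣p∣≡∣q∣⇒p≡q (yPart-mono A⊆A′))

  height-mono : ∀ {A A′} → A ⊆ A′ → height (setApex outside A) ≤ height (setApex outside A′)
  height-mono {A} {A′} A⊆A′ with yPart A ≟ˢ yPart A′
  ... | no differ = ℕ.<⇒≤ (height-strict outside outside A⊆A′ differ)
  ... | yes same  = begin
    height (setApex outside A)                    ≡⟨ height-setApex outside A ⟩
    ∣ setApex outside A ∣ + suc N * ∣ yPart A ∣    ≤⟨ ℕ.+-mono-≤ sizes (ℕ.≤-reflexive (cong (λ V → suc N * ∣ V ∣) same)) ⟩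
    ∣ setApex outside A′ ∣ + suc N * ∣ yPart A′ ∣  ≡⟨ height-setApex outside A′ ⟨
    height (setApex outside A′)                   ∎
    where
    open ℕ.≤-Reasoning
    sizes : ∣ setApex outside A ∣ ≤ ∣ setApex outside A′ ∣
    sizes = p⊆q⇒∣p∣≤∣q∣ (setApex-mono outside A⊆A′ same)

  height-injective : ∀ {A A′} → A ⊆ A′ → height (setApex outside A) ≡ height (setApex outside A′) →
                     setApex outside A ≡ setApex outside A′
  height-injective {A} {A′} A⊆A′ eq with yPart A ≟ˢ yPart A′
  ... | no differ = ⊥-elim (<-irrefl eq (height-strict outside outside A⊆A′ differ))
  ... | yes same  = p⊆q∧∣p∣≡∣q∣⇒p≡q (setApex-mono outside A⊆A′ same) (ℕ.+-cancelʳ-≡ _ _ _ sizes)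
    where
    sizes : ∣ setApex outside A ∣ + suc N * ∣ yPart A′ ∣ ≡ ∣ setApex outside A′ ∣ + suc N * ∣ yPart A′ ∣
    sizes = begin
      ∣ setApex outside A ∣ + suc N * ∣ yPart A′ ∣   ≡⟨ cong (λ V → ∣ setApex outside A ∣ + suc N * ∣ V ∣) same ⟨
      ∣ setApex outside A ∣ + suc N * ∣ yPart A ∣    ≡⟨ height-setApex outside A ⟨
      height (setApex outside A)                   ≡⟨ eq ⟩
      height (setApex outside A′)                  ≡⟨ height-setApex outside A′ ⟩
      ∣ setApex outside A′ ∣ + suc N * ∣ yPart A′ ∣  ∎
      where open ≡-Reasoning

  pairing : GradedPairing B∖Cx
  pairing = record
    { lower            = setApex outside
    ; upper            = setApex inside
    ; height           = height
    ; maxHeight        = suc (N + suc N * b)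
    ; lower-D          = lower-B∖Cx
    ; upper-D          = λ {A} b →
                           subst B∖Cx (sym (setApex-setApex inside outside A)) (upper-B∖Cx b)
    ; lower-lower      = λ {A} _ → setApex-setApex outside outside A
    ; lower-upper      = λ {A} _ → trans (setApex-setApex outside inside (setApex outside A))
                                         (setApex-setApex outside outside A)
    ; lower-or-upper   = λ {A} _ → map₂ (λ A≡ → trans A≡ (sym (setApex-setApex inside outside A)))
                                                 (toggle-lookup (apex (yPart A)) A)
    ; lower≺upper      = lower≺upper
    ; height<max       = λ {A} _ → height<max (setApex outside A)
    ; height-mono      = λ A⊆A′ _ _ → height-mono A⊆A′
    ; height-injective = λ A⊆A′ _ _ → height-injective A⊆A′
    }

  collapses : Collapses B Cx
  collapses = Collapses-respˡ B≅Cx∪B∖Cx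
    (PairingCollapse.collapses Cx-simplicial Cx∪B∖Cx-simplicial Cx∩B∖Cx-empty B∖Cx? pairing)

↑ˡ≢↑ʳ : ∀ {m n} (i : Fin m) (j : Fin n) → i ↑ˡ n ≢ m ↑ʳ j
↑ˡ≢↑ʳ {m} {n} i j eq
  with trans (sym (splitAt-↑ˡ m i n)) (trans (cong (splitAt m) eq) (splitAt-↑ʳ m n j))
... | ()

↑ˡ-↑ʳ-cover : ∀ m n (k : Fin (m + n)) → (∃ λ i → i ↑ˡ n ≡ k) ⊎ (∃ λ j → m ↑ʳ j ≡ k)
↑ˡ-↑ʳ-cover m n k with splitAt m k in eq
... | inj₁ i = inj₁ (i , splitAt⁻¹-↑ˡ eq)
... | inj₂ j = inj₂ (j , splitAt⁻¹-↑ʳ eq)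

theorem6p1 : (m n : ℕ) (R : Fin m → Fin n → Bool) →
    Collapses (BicliqueComplex R) (CX R) × Collapses (BicliqueComplex R) (CY R)
theorem6p1 m n R =
  CollapseToCx.collapses (_↑ˡ n) (m ↑ʳ_) (↑ˡ-injective n _ _) ↑ˡ≢↑ʳ (↑ˡ-↑ʳ-cover m n) R ,
  Collapses-respˡ (B-transpose (_↑ˡ n) (m ↑ʳ_) R)
    (CollapseToCx.collapses (m ↑ʳ_) (_↑ˡ n) (↑ʳ-injective m _ _) (λ j i → ↑ˡ≢↑ʳ i j ∘ sym)
       (swap ∘ ↑ˡ-↑ʳ-cover m n) (flip R))
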